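{- Let $\mathcal{C}$ be a class of Kripke models that is closed under submodels and under colimits (computed in the category of Kripke models and homomorphisms), or a class of finite Kripke models closed under submodels and finite colimits. Suppose that $A\in\mathcal{C}$ implies $R_kA\in\mathcal{C}$ for every finite ordinal $k$. Then for every finite $k$ and every modal formula $\phi$ of modal depth at most $k$: $\phi$ is preserved under extensions within $\mathcal{C}$ (i.e. for every embedding $A'\to A$ with $A',A\in\mathcal{C}$, $A'\models\phi$ implies $A\models\phi$) if and only if there is an existential modal formula $\psi$ of modal depth at most $k$ such that for all $A\in\mathcal{C}$, $A\models\phi$ iff $A\models\psi$.
   Context: A Kripke model $(A,a)$ is a set with a binary accessibility relation $R$, subsets $\mathscr{P}^A$ for the unary relation symbols $\mathscr{P}$ (one per propositional variable $p$), and a distinguished element $a$; homomorphisms preserve $R$, unary relations and distinguished element; an embedding (into $A$, whose image is a submodel) is an injective homomorphism reflecting unary relations and $R$. Modal formulas are built from propositional variables, $\top,\bot,\wedge,\vee,\neg,\Box,\Diamond$, with the standard Kripke semantics at the distinguished element ($(A,a)\models\Diamond\psi$ iff $(A,x)\models\psi$ for some $x$ with $aRx$; dually for $\Box$). Modal depth is the maximal nesting of $\Box,\Diamond$. A modal formula is existential if it does not contain $\Box$ and every subformula in the scope of a negation is a propositional variable. The unravelling $R_k(A,a)$ has elements the sequences $[a_0,\dots,a_j]$ of length at most $k$ with $a_0=a$ and $a_\ell Ra_{\ell+1}$; $sRt$ iff $t$ extends $s$ by one element; a sequence lies in $\mathscr{P}$ iff its last element lies in $\mathscr{P}^A$; the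 distinguished element is $[a]$. -}

module Defs where

open import Level using (0ℓ)
open import Data.Nat using (ℕ; zero; suc; _≤_; z≤n; _⊔_)
open import Data.Fin using (Fin)
open import Data.List using (List; []; _∷_; _∷ʳ_; length)
open import Data.Product using (Σ; _×_; _,_)
open import Data.Sum using (_⊎_)
open import Data.Empty using (⊥)
open import Data.Unit using (⊤)
open import Relation.Nullary using (¬_)
open import Relation.Binary.PropositionalEquality using (_≡_)
open import Function.Bundles using (_↔_)

Finite : Set → Set
Finite X = Σ ℕ λ n → X ↔ Fin n

record KripkeModel (Var : Set) : Set₁ where
  field
    W     : Set
    R     : W → W → Set
    P     : Var → W → Set
    point : W

open KripkeModel public

module _ {Var : Set} where

  record KHom (A B : KripkeModel Var) : Set where
    field
      fun        : W A → W B
      pres-R     : ∀ {x y} → R A x y → R B (fun x) (fun y)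
      pres-P     : ∀ p {x} → P A p x → P B p (fun x)
      pres-point : fun (point A) ≡ point B

  open KHom public

  _≈ₕ_ : ∀ {A B} → KHom A B → KHom A B → Set
  f ≈ₕ g = ∀ x → fun f x ≡ fun g x

  idₕ : ∀ {A} → KHom A A
  idₕ = record { fun = λ x → x ; pres-R = λ r → r ; pres-P = λ p q → q
               ; pres-point = Relation.Binary.PropositionalEquality.refl }

  _∘ₕ_ : ∀ {A B C} → KHom B C → KHom A B → KHom A C
  g ∘ₕ f = record
    { fun = λ x → fun g (fun f x)
    ; pres-R = λ r → pres-R g (pres-R f r)
    ; pres-P = λ p q → pres-P g p (pres-P f p q)
    ; pres-point = Relation.Binary.PropositionalEquality.trans
                     (Relation.Binary.PropositionalEquality.cong (fun g) (pres-point f))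
                     (pres-point g) }

  record Embedding (A B : KripkeModel Var) : Set where
    field
      hom       : KHom A B
      injective : ∀ {x y} → fun hom x ≡ fun hom y → x ≡ y
      refl-R    : ∀ {x y} → R B (fun hom x) (fun hom y) → R A x y
      refl-P    : ∀ p {x} → P B p (fun hom x) → P A p x

record Category : Set₁ where
  field
    Obj       : Set
    Hom       : Obj → Obj → Set
    id        : ∀ {i} → Hom i i
    _∘_       : ∀ {i j k} → Hom j k → Hom i j → Hom i k
    identityˡ : ∀ {i j} (f : Hom i j) → id ∘ f ≡ f
    identityʳ : ∀ {i j} (f : Hom i j) → f ∘ id ≡ f
    assoc     : ∀ {i j k l} (h : Hom k l) (g : Hom j k) (f : Hom i j) →
                (h ∘ g) ∘ f ≡ h ∘ (g ∘ f)

open Category public using (Obj)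

FiniteCategory : Category → Set
FiniteCategory J = Finite (Category.Obj J) × (∀ i j → Finite (Category.Hom J i j))

module _ {Var : Set} where

  record Diagram (J : Category) : Set₁ where
    field
      obj    : Category.Obj J → KripkeModel Var
      mor    : ∀ {i j} → Category.Hom J i j → KHom (obj i) (obj j)
      mor-id : ∀ {i} → mor (Category.id J {i}) ≈ₕ idₕ
      mor-∘  : ∀ {i j k} (g : Category.Hom J j k) (f : Category.Hom J i j) →
               mor (Category._∘_ J g f) ≈ₕ (mor g ∘ₕ mor f)

  open Diagram public

  record Cocone {J : Category} (D : Diagram J) (L : KripkeModel Var) : Set where
    field
      inj     : ∀ i → KHom (obj D i) L
      commute : ∀ {i j} (f : Category.Hom J i j) → (inj j ∘ₕ mor D f) ≈ₕ inj i

  open Cocone public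

  IsColimit : {J : Category} (D : Diagram J) (L : KripkeModel Var) → Cocone D L → Set₁
  IsColimit {J} D L c =
    ∀ (M : KripkeModel Var) (c' : Cocone D M) →
      Σ (KHom L M) λ u →
        (∀ i → (u ∘ₕ inj c i) ≈ₕ inj c' i) ×
        (∀ (v : KHom L M) → (∀ i → (v ∘ₕ inj c i) ≈ₕ inj c' i) → v ≈ₕ u)

  ClosedUnderColimits : (KripkeModel Var → Set) → Set₁
  ClosedUnderColimits C =
    ∀ (J : Category) (D : Diagram J) → (∀ i → C (obj D i)) →
      ∀ (L : KripkeModel Var) (c : Cocone D L) → IsColimit D L c → C L

  ClosedUnderFiniteColimits : (KripkeModel Var → Set) → Set₁
  ClosedUnderFiniteColimits C =
    ∀ (J : Category) → FiniteCategory J → (D : Diagram J) → (∀ i → C (obj D i)) →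
      ∀ (L : KripkeModel Var) (c : Cocone D L) → IsColimit D L c → C L

-- Submodels: a subset S of the carrier containing the point, with the
-- induced structure.  Membership proofs are irrelevant, so the carrier is
-- exactly the subset.

  record SubElem (A : KripkeModel Var) (S : W A → Set) : Set where
    field
      elem : W A
      .mem : S elem

  open SubElem public

  Submodel : (A : KripkeModel Var) (S : W A → Set) → S (point A) → KripkeModel Var
  Submodel A S s = record
    { W = SubElem A S
    ; R = λ x y → R A (elem x) (elem y)
    ; P = λ p x → P A p (elem x)
    ; point = record { elem = point A ; mem = s } }

  ClosedUnderSubmodels : (KripkeModel Var → Set) → Set₁
  ClosedUnderSubmodels C =
    ∀ (A : KripkeModel Var) → C A → (S : W A → Set) (s : S (point A)) → C (Submodel A S s)

-- Unravelling R_k(A,a): sequences [a, a₁, …, a_j] with j ≤ k and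
-- a R a₁ R … R a_j.  We store the tail [a₁, …, a_j] ("steps").

  data Chain (A : KripkeModel Var) : W A → List (W A) → Set where
    []  : ∀ {x} → Chain A x []
    _∷_ : ∀ {x y ys} → R A x y → Chain A y ys → Chain A x (y ∷ ys)

  record UElem (A : KripkeModel Var) (k : ℕ) : Set where
    field
      steps  : List (W A)
      .bound : length steps ≤ k
      .chain : Chain A (point A) steps

  open UElem public

lastFrom : {X : Set} → X → List X → X
lastFrom x []       = x
lastFrom x (y ∷ ys) = lastFrom y ys

module _ {Var : Set} where

  Unravel : KripkeModel Var → ℕ → KripkeModel Var
  Unravel A k = record
    { W = UElem A k
    ; R = λ s t → Σ (W A) λ x → steps t ≡ steps s ∷ʳ x
    ; P = λ p s → P A p (lastFrom (point A) (steps s))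
    ; point = record { steps = [] ; bound = z≤n ; chain = [] } }

data Formula (Var : Set) : Set where
  var       : Var → Formula Var
  ⊤ᶠ ⊥ᶠ     : Formula Var
  _∧ᶠ_ _∨ᶠ_ : Formula Var → Formula Var → Formula Var
  ¬ᶠ_       : Formula Var → Formula Var
  □_ ◇_     : Formula Var → Formula Var

module _ {Var : Set} where

  depth : Formula Var → ℕ
  depth (var p)  = 0
  depth ⊤ᶠ       = 0
  depth ⊥ᶠ       = 0
  depth (φ ∧ᶠ ψ) = depth φ ⊔ depth ψ
  depth (φ ∨ᶠ ψ) = depth φ ⊔ depth ψ
  depth (¬ᶠ φ)   = depth φ
  depth (□ φ)    = suc (depth φ)
  depth (◇ φ)    = suc (depth φ)

  data IsExistential : Formula Var → Set where
    var  : ∀ p → IsExistential (var p)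
    nvar : ∀ p → IsExistential (¬ᶠ (var p))
    ⊤ᶠ   : IsExistential ⊤ᶠ
    ⊥ᶠ   : IsExistential ⊥ᶠ
    _∧ᶠ_ : ∀ {φ ψ} → IsExistential φ → IsExistential ψ → IsExistential (φ ∧ᶠ ψ)
    _∨ᶠ_ : ∀ {φ ψ} → IsExistential φ → IsExistential ψ → IsExistential (φ ∨ᶠ ψ)
    ◇_   : ∀ {φ} → IsExistential φ → IsExistential (◇ φ)

  Sat : (A : KripkeModel Var) → W A → Formula Var → Set
  Sat A w (var p)  = P A p w
  Sat A w ⊤ᶠ       = ⊤
  Sat A w ⊥ᶠ       = ⊥
  Sat A w (φ ∧ᶠ ψ) = Sat A w φ × Sat A w ψ
  Sat A w (φ ∨ᶠ ψ) = Sat A w φ ⊎ Sat A w ψ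
  Sat A w (¬ᶠ φ)   = ¬ Sat A w φ
  Sat A w (□ φ)    = ∀ v → R A w v → Sat A v φ
  Sat A w (◇ φ)    = Σ (W A) λ v → R A w v × Sat A v φ

  _⊨_ : KripkeModel Var → Formula Var → Set
  A ⊨ φ = Sat A (point A) φ

  PreservedUnderExtensionsWithin : (KripkeModel Var → Set) → Formula Var → Set₁
  PreservedUnderExtensionsWithin C φ =
    ∀ (A' A : KripkeModel Var) → C A' → C A → Embedding A' A → A' ⊨ φ → A ⊨ φ

{-# OPTIONS --safe #-}
module Submission where

-- Existential formulas are preserved by embeddings, which gives one direction.  For the
-- other, let φ be preserved under extensions within C.  If A satisfies the depth-k
-- characteristic formula (over the variables of φ) of a model M of φ in C, then A
-- k-simulates M.  Unravel A to depth k while tagging every step with a world of M: the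
-- result T is k-bisimilar to A, and it is a colimit of unravellings of A (one for each
-- sequence of tags), so T ∈ C.  The nodes of T whose tags follow an M-path simulated by
-- the A-path form a submodel N ∈ C that is k-bisimilar to M.  Hence M ⊨ φ gives N ⊨ φ,
-- then T ⊨ φ by preservation, then A ⊨ φ.  So on C, φ is equivalent to the disjunction
-- of the characteristic formulas of its models in C, an existential formula of depth k;
-- it is finite because there are only finitely many characteristic formulas.

open import Defs
open import Level using (0ℓ; lift; lower)
open import Axiom.ExcludedMiddle using (ExcludedMiddle)
open import Data.Nat using (ℕ; zero; suc; _≤_; z≤n; s≤s; _+_; _∸_; _*_; _≤?_)
open import Data.Nat.Properties
  using (≤-trans; ≤-reflexive; ⊔-lub; m⊔n≤o⇒m≤o; m⊔n≤o⇒n≤o; m≤m+n; +-suc; m+n∸m≡n)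
open import Data.Fin using (zero)
open import Data.Fin.Properties using (+↔⊎; *↔×; 1↔⊤)
open import Data.Product using (Σ; ∃-syntax; _×_; _,_; proj₁; proj₂)
open import Data.Product.Function.NonDependent.Propositional using (_×-⇔_; _×-↔_)
open import Data.Sum using (_⊎_; inj₁; inj₂; [_,_]′)
open import Data.Sum.Function.Propositional using (_⊎-⇔_; _⊎-↔_)
open import Data.Empty using (⊥; ⊥-elim)
open import Data.Unit using (⊤; tt)
open import Data.List using (List; []; _∷_; _++_; _∷ʳ_; map; length; foldr; filter)
open import Data.List.Properties using (∷ʳ-injective; ∷-injective; map-++; length-++-≤ˡ; length-map)
open import Data.List.Membership.Propositional using (_∈_; find; lose)
open import Data.List.Membership.Propositional.Properties using (∈-map⁺; ∈-filter⁺; ∈-filter⁻)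
open import Data.List.Relation.Unary.Any using (Any; here; there)
open import Data.List.Relation.Unary.All using (All; []; _∷_; universal)
import Data.List.Relation.Unary.All as All
open import Data.List.Relation.Unary.All.Properties
  using (++⁺; map⁺) renaming (filter⁺ to All-filter⁺)
open import Data.List.Relation.Binary.Subset.Propositional using (_⊆_)
open import Data.List.Relation.Binary.Subset.Propositional.Properties using (xs⊆xs++ys; xs⊆ys++xs)
open import Relation.Nullary using (¬_; Dec; yes; no)
open import Relation.Nullary.Decidable using (map′; recompute)
open import Relation.Unary using (Decidable)
open import Relation.Binary.PropositionalEquality
  using (_≡_; refl; sym; trans; cong; subst; subst₂; module ≡-Reasoning)
open import Function using (_∘_; id)
open import Function.Bundles using (_⇔_; mk⇔; mk↔ₛ′; Equivalence)
open import Function.Construct.Identity using (⇔-id; ↔-id)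
open import Function.Properties.Inverse using (↔-sym; ↔-trans)
open import Function.Related.TypeIsomorphisms using (¬-cong-⇔)

open Equivalence using (to; from)

module _ {X : Set} where

  lastFrom-∷ʳ : (d : X) (xs : List X) (x : X) → lastFrom d (xs ∷ʳ x) ≡ x
  lastFrom-∷ʳ d []       x = refl
  lastFrom-∷ʳ d (y ∷ xs) x = lastFrom-∷ʳ y xs x

  length-∷ʳ : (xs : List X) (x : X) → length (xs ∷ʳ x) ≡ suc (length xs)
  length-∷ʳ []       x = refl
  length-∷ʳ (y ∷ xs) x = cong suc (length-∷ʳ xs x)

[]≢∷ʳ : {X : Set} (xs : List X) (x : X) → [] ≡ xs ∷ʳ x → ⊥
[]≢∷ʳ []       x ()
[]≢∷ʳ (y ∷ xs) x ()

lastFrom-map : {X Y : Set} (f : X → Y) (d : X) (xs : List X) →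
               lastFrom (f d) (map f xs) ≡ f (lastFrom d xs)
lastFrom-map f d []       = refl
lastFrom-map f d (x ∷ xs) = lastFrom-map f x xs

module Classical (em : ExcludedMiddle (Level.suc 0ℓ)) where

  dec : (Q : Set) → Dec Q
  dec Q = map′ lower lift em

  -- Recovers the irrelevant chain and membership fields of unravellings and submodels.
  recover : {Q : Set} → .Q → Q
  recover = recompute (dec _)

module _ {Var : Set} where

  elem-injective : {A : KripkeModel Var} {S : W A → Set} {x y : SubElem A S} →
                   elem x ≡ elem y → x ≡ y
  elem-injective refl = refl

  submodel-embedding : (A : KripkeModel Var) (S : W A → Set) (s : S (point A)) →
                       Embedding (Submodel A S s) A
  submodel-embedding A S s = record
    { hom       = record { fun = elem ; pres-R = id ; pres-P = λ _ → id ; pres-point = refl }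
    ; injective = elem-injective
    ; refl-R    = id
    ; refl-P    = λ _ → id }

  chain-∷ʳ : ∀ {X : KripkeModel Var} {x xs y} →
             Chain X x xs → R X (lastFrom x xs) y → Chain X x (xs ∷ʳ y)
  chain-∷ʳ []      r = r ∷ []
  chain-∷ʳ (r′ ∷ c) r = r′ ∷ chain-∷ʳ c r

  chain-∷ʳ⁻ : ∀ {X : KripkeModel Var} {x} xs {y} → Chain X x (xs ∷ʳ y) → R X (lastFrom x xs) y
  chain-∷ʳ⁻ []       (r ∷ c) = r
  chain-∷ʳ⁻ (z ∷ xs) (r ∷ c) = chain-∷ʳ⁻ xs c

  chain-map : ∀ {X Y : KripkeModel Var} (f : W X → W Y) → (∀ {x y} → R X x y → R Y (f x) (f y)) →
              ∀ {x xs} → Chain X x xs → Chain Y (f x) (map f xs)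
  chain-map f f-R []      = []
  chain-map f f-R (r ∷ c) = f-R r ∷ chain-map f f-R c

  tip : {X : KripkeModel Var} {k : ℕ} → UElem X k → W X
  tip {X} t = lastFrom (point X) (steps t)

  steps-injective : ∀ {X : KripkeModel Var} {k} {s t : UElem X k} → steps s ≡ steps t → s ≡ t
  steps-injective {s = record { steps = xs }} {t = record { steps = .xs }} refl = refl

  length-steps : ∀ {X : KripkeModel Var} {k} (t : UElem X k) → length (steps t) ≤ k
  length-steps {k = k} t@record { bound = b } = recompute (length (steps t) ≤? k) b

  widen : ∀ {X : KripkeModel Var} {m n} → UElem X m → m ≤ n → UElem X n
  widen record { steps = xs ; bound = b ; chain = c } m≤n =
    record { steps = xs ; bound = ≤-trans b m≤n ; chain = c }

  extend : ∀ {X : KripkeModel Var} {k} (t : UElem X k) {y} →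
           R X (tip t) y → suc (length (steps t)) ≤ k → UElem X k
  extend record { steps = xs ; chain = c } {y} r room = record
    { steps = xs ∷ʳ y
    ; bound = ≤-trans (≤-reflexive (length-∷ʳ xs y)) room
    ; chain = chain-∷ʳ c r }

  tip-∷ʳ : ∀ {X : KripkeModel Var} {k} (s t : UElem X k) {x} →
           steps t ≡ steps s ∷ʳ x → tip t ≡ x
  tip-∷ʳ {X} s t {x} e = trans (cong (lastFrom (point X)) e) (lastFrom-∷ʳ _ (steps s) x)


unravel-edge : ExcludedMiddle (Level.suc 0ℓ) → ∀ {Var} {X : KripkeModel Var} {n} (s t : UElem X n) →
               R (Unravel X n) s t → R X (tip s) (tip t)
unravel-edge em {X = X} s t@record { chain = c } (x , e) =
  subst (R X (tip s)) (sym (tip-∷ʳ s t e))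
    (recover (chain-∷ʳ⁻ (steps s) (subst (Chain X (point X)) e c)))
  where open Classical em

module _ {Var : Set} where

  vars : Formula Var → List Var
  vars (var p)  = p ∷ []
  vars ⊤ᶠ       = []
  vars ⊥ᶠ       = []
  vars (φ ∧ᶠ ψ) = vars φ ++ vars ψ
  vars (φ ∨ᶠ ψ) = vars φ ++ vars ψ
  vars (¬ᶠ φ)   = vars φ
  vars (□ φ)    = vars φ
  vars (◇ φ)    = vars φ

  Existential≤ : ℕ → Formula Var → Set
  Existential≤ j ψ = IsExistential ψ × depth ψ ≤ j

  Sat-existential-embedding : ∀ {A′ A : KripkeModel Var} {ψ} → IsExistential ψ →
                              (e : Embedding A′ A) →
                              ∀ {x} → Sat A′ x ψ → Sat A (fun (Embedding.hom e) x) ψ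
  Sat-existential-embedding (var p)  e s           = pres-P (Embedding.hom e) p s
  Sat-existential-embedding (nvar p) e s           = s ∘ Embedding.refl-P e p
  Sat-existential-embedding ⊤ᶠ       e s           = tt
  Sat-existential-embedding (i ∧ᶠ j) e (s , t)     =
    Sat-existential-embedding i e s , Sat-existential-embedding j e t
  Sat-existential-embedding (i ∨ᶠ j) e (inj₁ s)    = inj₁ (Sat-existential-embedding i e s)
  Sat-existential-embedding (i ∨ᶠ j) e (inj₂ t)    = inj₂ (Sat-existential-embedding j e t)
  Sat-existential-embedding (◇ i)    e (v , r , s) =
    fun (Embedding.hom e) v , pres-R (Embedding.hom e) r , Sat-existential-embedding i e s

  existential⇒preserved : ∀ {ψ} → IsExistential ψ → (C : KripkeModel Var → Set) →
                          PreservedUnderExtensionsWithin C ψ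
  existential⇒preserved {ψ} ex C A′ A _ _ e s =
    subst (λ a → Sat A a ψ) (pres-point (Embedding.hom e)) (Sat-existential-embedding ex e s)

  preserved-resp-⇔ : ∀ {C : KripkeModel Var → Set} {φ ψ} → (∀ A → C A → A ⊨ φ ⇔ A ⊨ ψ) →
                     PreservedUnderExtensionsWithin C ψ → PreservedUnderExtensionsWithin C φ
  preserved-resp-⇔ φ⇔ψ preserved A′ A A′∈C A∈C e =
    from (φ⇔ψ A A∈C) ∘ preserved A′ A A′∈C A∈C e ∘ to (φ⇔ψ A′ A′∈C)

  ⋁ : List (Formula Var) → Formula Var
  ⋁ = foldr _∨ᶠ_ ⊥ᶠ

  Sat-⋁ : ∀ {X : KripkeModel Var} {x} fs → Sat X x (⋁ fs) ⇔ Any (Sat X x) fs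
  Sat-⋁ {X} {x} fs = mk⇔ (⇒ fs) (⇐ fs)
    where
      ⇒ : ∀ fs → Sat X x (⋁ fs) → Any (Sat X x) fs
      ⇒ (f ∷ fs) (inj₁ s) = here s
      ⇒ (f ∷ fs) (inj₂ s) = there (⇒ fs s)
      ⇐ : ∀ fs → Any (Sat X x) fs → Sat X x (⋁ fs)
      ⇐ (f ∷ fs) (here s)  = inj₁ s
      ⇐ (f ∷ fs) (there s) = inj₂ (⇐ fs s)

  ⋁-existential≤ : ∀ {j fs} → All (Existential≤ j) fs → Existential≤ j (⋁ fs)
  ⋁-existential≤ []             = ⊥ᶠ , z≤n
  ⋁-existential≤ ((e , d) ∷ es) = let e′ , d′ = ⋁-existential≤ es in e ∨ᶠ e′ , ⊔-lub d d′

module BoundedBisimulation {Var : Set} (V : List Var) where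

  Agree : (X Y : KripkeModel Var) → W X → W Y → Set
  Agree X Y x y = ∀ {p} → p ∈ V → P X p x ⇔ P Y p y

  Forth : (X Y : KripkeModel Var) → (W X → W Y → Set) → W X → W Y → Set
  Forth X Y Z x y = ∀ {x′} → R X x x′ → ∃[ y′ ] R Y y y′ × Z x′ y′

  Back : (X Y : KripkeModel Var) → (W X → W Y → Set) → W X → W Y → Set
  Back X Y Z x y = ∀ {y′} → R Y y y′ → ∃[ x′ ] R X x x′ × Z x′ y′

  Bisim : (X Y : KripkeModel Var) → ℕ → W X → W Y → Set
  Bisim X Y zero    x y = Agree X Y x y
  Bisim X Y (suc j) x y = Agree X Y x y × Forth X Y (Bisim X Y j) x y × Back X Y (Bisim X Y j) x y

  Sim : (X Y : KripkeModel Var) → ℕ → W X → W Y → Set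
  Sim X Y zero    x y = Agree X Y x y
  Sim X Y (suc j) x y = Agree X Y x y × Forth X Y (Sim X Y j) x y

  Bisim⇒Agree : ∀ {X Y} j {x y} → Bisim X Y j x y → Agree X Y x y
  Bisim⇒Agree zero    b = b
  Bisim⇒Agree (suc j) b = proj₁ b

  Sat-bisim : ∀ {X Y} φ {j x y} → depth φ ≤ j → vars φ ⊆ V →
              Bisim X Y j x y → Sat X x φ ⇔ Sat Y y φ
  Sat-bisim (var p) {j} _ φ⊆V b = Bisim⇒Agree j b (φ⊆V (here refl))
  Sat-bisim ⊤ᶠ        _ _ _ = ⇔-id _
  Sat-bisim ⊥ᶠ        _ _ _ = ⇔-id _
  Sat-bisim (φ ∧ᶠ ψ) d φ⊆V b =
    Sat-bisim φ (m⊔n≤o⇒m≤o _ _ d) (φ⊆V ∘ xs⊆xs++ys _ _) b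
      ×-⇔ Sat-bisim ψ (m⊔n≤o⇒n≤o _ _ d) (φ⊆V ∘ xs⊆ys++xs _ _) b
  Sat-bisim (φ ∨ᶠ ψ) d φ⊆V b =
    Sat-bisim φ (m⊔n≤o⇒m≤o _ _ d) (φ⊆V ∘ xs⊆xs++ys _ _) b
      ⊎-⇔ Sat-bisim ψ (m⊔n≤o⇒n≤o _ _ d) (φ⊆V ∘ xs⊆ys++xs _ _) b
  Sat-bisim (¬ᶠ φ) d φ⊆V b = ¬-cong-⇔ (Sat-bisim φ d φ⊆V b)
  Sat-bisim (□ φ) (s≤s d) φ⊆V (_ , forth , back) = mk⇔
    (λ h y′ r → let x′ , r′ , b′ = back r  in to   (Sat-bisim φ d φ⊆V b′) (h x′ r′))
    (λ h x′ r → let y′ , r′ , b′ = forth r in from (Sat-bisim φ d φ⊆V b′) (h y′ r′))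
  Sat-bisim (◇ φ) (s≤s d) φ⊆V (_ , forth , back) = mk⇔
    (λ (x′ , r , s) → let y′ , r′ , b′ = forth r in y′ , r′ , to   (Sat-bisim φ d φ⊆V b′) s)
    (λ (y′ , r , s) → let x′ , r′ , b′ = back r  in x′ , r′ , from (Sat-bisim φ d φ⊆V b′) s)

module Characteristic (em : ExcludedMiddle (Level.suc 0ℓ)) {Var : Set} (V : List Var) where
  open Classical em
  open BoundedBisimulation V

  Fm : Set
  Fm = Formula Var

  -- A choice (a , b) has b as a fallback where a fails; chosen X x cs picks from each
  -- choice a side true at x, and conjunctions cs lists all possible picks.
  conjunctions : List (Fm × Fm) → List Fm
  conjunctions []             = ⊤ᶠ ∷ []
  conjunctions ((a , b) ∷ cs) = map (a ∧ᶠ_) (conjunctions cs) ++ map (b ∧ᶠ_) (conjunctions cs)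

  chosen : (X : KripkeModel Var) → W X → List (Fm × Fm) → Fm
  chosen X x []             = ⊤ᶠ
  chosen X x ((a , b) ∷ cs) with dec (Sat X x a)
  ... | yes _ = a ∧ᶠ chosen X x cs
  ... | no _  = b ∧ᶠ chosen X x cs

  chosen∈conjunctions : ∀ X x cs → chosen X x cs ∈ conjunctions cs
  chosen∈conjunctions X x []             = here refl
  chosen∈conjunctions X x ((a , b) ∷ cs) with dec (Sat X x a)
  ... | yes _ = xs⊆xs++ys _ _ (∈-map⁺ (a ∧ᶠ_) (chosen∈conjunctions X x cs))
  ... | no _  = xs⊆ys++xs _ _ (∈-map⁺ (b ∧ᶠ_) (chosen∈conjunctions X x cs))

  Exhaustive : Fm × Fm → Set₁
  Exhaustive (a , b) = ∀ {X x} → ¬ Sat X x a → Sat X x b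

  Sat-chosen : ∀ {X x cs} → All Exhaustive cs → Sat X x (chosen X x cs)
  Sat-chosen {cs = []}           []       = tt
  Sat-chosen {X} {x} {(a , b) ∷ cs} (ex ∷ exs) with dec (Sat X x a)
  ... | yes s = s    , Sat-chosen exs
  ... | no ¬s = ex ¬s , Sat-chosen exs

  chosen-transfer : ∀ {X Y x y a b} cs → (a , b) ∈ cs → Sat Y y (chosen X x cs) →
                    (Sat X x a → Sat Y y a) × (¬ Sat X x a → Sat Y y b)
  chosen-transfer {X} {x = x} ((a′ , b′) ∷ cs) m s with dec (Sat X x a′) | m | s
  ... | yes sa | here refl | s′ , _ = (λ _ → s′) , (λ ¬sa → ⊥-elim (¬sa sa))
  ... | no ¬sa | here refl | s′ , _ = (λ sa → ⊥-elim (¬sa sa)) , (λ _ → s′)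
  ... | yes _  | there m′  | _ , s′ = chosen-transfer cs m′ s′
  ... | no _   | there m′  | _ , s′ = chosen-transfer cs m′ s′

  BothExistential≤ : ℕ → Fm × Fm → Set
  BothExistential≤ j (a , b) = Existential≤ j a × Existential≤ j b

  conjunctions-existential≤ : ∀ {j cs} → All (BothExistential≤ j) cs →
                              All (Existential≤ j) (conjunctions cs)
  conjunctions-existential≤ [] = (⊤ᶠ , z≤n) ∷ []
  conjunctions-existential≤ {j} {_ ∷ cs} (((ea , da) , (eb , db)) ∷ good) =
    ++⁺ (map⁺ (All.map (λ (e , d) → ea ∧ᶠ e , ⊔-lub da d) rest))
        (map⁺ (All.map (λ (e , d) → eb ∧ᶠ e , ⊔-lub db d) rest))
    where
      rest : All (Existential≤ j) (conjunctions cs)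
      rest = conjunctions-existential≤ good

  literals : List (Fm × Fm)
  literals = map (λ p → var p , ¬ᶠ var p) V

  diamonds : List Fm → List (Fm × Fm)
  diamonds = map (λ f → ◇ f , ⊤ᶠ)

  choices : ℕ → List (Fm × Fm)
  choices zero    = literals
  choices (suc j) = literals ++ diamonds (conjunctions (choices j))

  characteristic : (X : KripkeModel Var) → ℕ → W X → Fm
  characteristic X j x = chosen X x (choices j)

  characteristic∈ : ∀ X j x → characteristic X j x ∈ conjunctions (choices j)
  characteristic∈ X j x = chosen∈conjunctions X x (choices j)

  choices-exhaustive : ∀ j → All Exhaustive (choices j)
  choices-exhaustive zero    = map⁺ (universal (λ _ {_} {_} ¬a → ¬a) V)
  choices-exhaustive (suc j) =
    ++⁺ (choices-exhaustive zero) (map⁺ (universal (λ _ {_} {_} _ → tt) (conjunctions (choices j))))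

  Sat-characteristic : ∀ X j x → Sat X x (characteristic X j x)
  Sat-characteristic X j x = Sat-chosen (choices-exhaustive j)

  literals⊆choices : ∀ j → literals ⊆ choices j
  literals⊆choices zero    = id
  literals⊆choices (suc j) = xs⊆xs++ys _ _

  characteristic⇒Agree : ∀ {X Y} j {x y} → Sat Y y (characteristic X j x) → Agree X Y x y
  characteristic⇒Agree {X} {Y} j {x} {y} s {p} p∈V = mk⇔ (proj₁ transfer) backward
    where
      transfer : (P X p x → P Y p y) × (¬ P X p x → ¬ P Y p y)
      transfer = chosen-transfer (choices j) (literals⊆choices j (∈-map⁺ _ p∈V)) s
      backward : P Y p y → P X p x
      backward py with dec (P X p x)
      ... | yes px = px
      ... | no ¬px = ⊥-elim (proj₂ transfer ¬px py)

  characteristic⇒Sim : ∀ {X Y} j {x y} → Sat Y y (characteristic X j x) → Sim X Y j x y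
  characteristic⇒Sim zero            s = characteristic⇒Agree zero s
  characteristic⇒Sim {X} {Y} (suc j) {x} {y} s = characteristic⇒Agree (suc j) s , forth
    where
      forth : Forth X Y (Sim X Y j) x y
      forth {x′} r =
        let y′ , r′ , s′ = proj₁ (chosen-transfer (choices (suc j)) ◇χ∈choices s)
                                 (x′ , r , Sat-characteristic X j x′)
        in y′ , r′ , characteristic⇒Sim j s′
        where
          ◇χ∈choices : (◇ characteristic X j x′ , ⊤ᶠ) ∈ choices (suc j)
          ◇χ∈choices = xs⊆ys++xs _ literals (∈-map⁺ _ (characteristic∈ X j x′))

  literals-existential≤ : ∀ j → All (BothExistential≤ j) literals
  literals-existential≤ j = map⁺ (universal (λ p → (var p , z≤n) , (nvar p , z≤n)) V)

  choices-existential≤ : ∀ j → All (BothExistential≤ j) (choices j)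
  choices-existential≤ zero    = literals-existential≤ zero
  choices-existential≤ (suc j) = ++⁺ (literals-existential≤ (suc j))
    (map⁺ (All.map (λ (e , d) → (◇ e , s≤s d) , (⊤ᶠ , z≤n))
                   (conjunctions-existential≤ (choices-existential≤ j))))

  characteristic-existential≤ : ∀ j → All (Existential≤ j) (conjunctions (choices j))
  characteristic-existential≤ j = conjunctions-existential≤ (choices-existential≤ j)


module Labels (I : Set) where

  Labels : ℕ → Set
  Labels zero    = ⊤
  Labels (suc n) = ⊤ ⊎ (I × Labels n)

  toList : ∀ {n} → Labels n → List I
  toList {zero}  _               = []
  toList {suc n} (inj₁ _)        = []
  toList {suc n} (inj₂ (i , x))  = i ∷ toList x

  fromList : ∀ {n} → List I → Labels n
  fromList {zero}  _       = tt
  fromList {suc n} []      = inj₁ tt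
  fromList {suc n} (i ∷ l) = inj₂ (i , fromList l)

  toList-fromList : ∀ {n} (l : List I) → length l ≤ n → toList (fromList {n} l) ≡ l
  toList-fromList {zero}  []      _       = refl
  toList-fromList {suc n} []      _       = refl
  toList-fromList {suc n} (i ∷ l) (s≤s p) = cong (i ∷_) (toList-fromList l p)

  length-toList : ∀ {n} (x : Labels n) → length (toList x) ≤ n
  length-toList {zero}  _              = z≤n
  length-toList {suc n} (inj₁ _)       = z≤n
  length-toList {suc n} (inj₂ (i , x)) = s≤s (length-toList x)

  infix 4 _≼_
  data _≼_ : ∀ {n} → Labels n → Labels n → Set where
    tt≼tt : _≼_ {zero} tt tt
    []≼   : ∀ {n} {y : Labels (suc n)} → inj₁ tt ≼ y
    ∷≼∷   : ∀ {n i} {x y : Labels n} → x ≼ y → inj₂ (i , x) ≼ inj₂ (i , y)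

  ≼-refl : ∀ {n} {x : Labels n} → x ≼ x
  ≼-refl {zero}                  = tt≼tt
  ≼-refl {suc n} {inj₁ tt}       = []≼
  ≼-refl {suc n} {inj₂ (i , x)}  = ∷≼∷ ≼-refl

  ≼-trans : ∀ {n} {x y z : Labels n} → x ≼ y → y ≼ z → x ≼ z
  ≼-trans tt≼tt   tt≼tt   = tt≼tt
  ≼-trans []≼     _       = []≼
  ≼-trans (∷≼∷ p) (∷≼∷ q) = ∷≼∷ (≼-trans p q)

  ≼-irrelevant : ∀ {n} {x y : Labels n} (p q : x ≼ y) → p ≡ q
  ≼-irrelevant tt≼tt   tt≼tt   = refl
  ≼-irrelevant []≼     []≼     = refl
  ≼-irrelevant (∷≼∷ p) (∷≼∷ q) = cong ∷≼∷ (≼-irrelevant p q)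

  ≼⇒++ : ∀ {n} {x y : Labels n} → x ≼ y → ∃[ r ] toList y ≡ toList x ++ r
  ≼⇒++ tt≼tt          = [] , refl
  ≼⇒++ {y = y} []≼    = toList y , refl
  ≼⇒++ {x = inj₂ (i , _)} (∷≼∷ p) with r , e ← ≼⇒++ p = r , cong (i ∷_) e

  ++⇒≼ : ∀ {n} (l : List I) (y : Labels n) {r} → toList y ≡ l ++ r → fromList l ≼ y
  ++⇒≼ {zero}  l       tt             _ = tt≼tt
  ++⇒≼ {suc n} []      y              _ = []≼
  ++⇒≼ {suc n} (i ∷ l) (inj₂ (j , y)) e with refl , e′ ← ∷-injective e = ∷≼∷ (++⇒≼ l y e′)

  ≼⇒length≤ : ∀ {n} {x y : Labels n} → x ≼ y → length (toList x) ≤ length (toList y)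
  ≼⇒length≤ {x = x} p with r , e ← ≼⇒++ p =
    subst (λ l → length (toList x) ≤ length l) (sym e) (length-++-≤ˡ (toList x))

  Prefixes : ℕ → Category
  Prefixes n = record
    { Obj = Labels n ; Hom = _≼_ ; id = ≼-refl ; _∘_ = λ q p → ≼-trans p q
    ; identityˡ = λ _ → ≼-irrelevant _ _
    ; identityʳ = λ _ → ≼-irrelevant _ _
    ; assoc     = λ _ _ _ → ≼-irrelevant _ _ }

module _ {Var : Set} where

  Labelled : KripkeModel Var → KripkeModel Var → KripkeModel Var
  Labelled A M = record
    { W = W A × W M ; R = λ x y → R A (proj₁ x) (proj₁ y)
    ; P = λ p x → P A p (proj₁ x) ; point = point A , point M }

-- T is glued from the unravellings of A of depth len x, one for each tag sequence x,
-- along the prefix order; a path in copy x is tagged with an initial segment of x.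
module LabelledColimit {Var : Set} (A M : KripkeModel Var) (k : ℕ) where
  open Labels (W M)

  T : KripkeModel Var
  T = Unravel (Labelled A M) k

  -- The padding with point M never occurs on a path no longer than its tags.
  tag : List (W A) → List (W M) → List (W A × W M)
  tag []       ls       = []
  tag (a ∷ as) []       = (a , point M) ∷ tag as []
  tag (a ∷ as) (i ∷ ls) = (a , i) ∷ tag as ls

  length-tag : ∀ as ls → length (tag as ls) ≡ length as
  length-tag []       ls       = refl
  length-tag (a ∷ as) []       = cong suc (length-tag as [])
  length-tag (a ∷ as) (i ∷ ls) = cong suc (length-tag as ls)

  chain-tag : ∀ {a as} ls i → Chain A a as → Chain (Labelled A M) (a , i) (tag as ls)
  chain-tag ls       i []      = []
  chain-tag []       i (r ∷ c) = r ∷ chain-tag [] (point M) c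
  chain-tag (j ∷ ls) i (r ∷ c) = r ∷ chain-tag ls j c

  tag-∷ʳ : ∀ as b ls → ∃[ i ] tag (as ∷ʳ b) ls ≡ tag as ls ∷ʳ (b , i)
  tag-∷ʳ []       b []       = point M , refl
  tag-∷ʳ []       b (i ∷ ls) = i , refl
  tag-∷ʳ (a ∷ as) b []       with i , e ← tag-∷ʳ as b []  = i , cong ((a , point M) ∷_) e
  tag-∷ʳ (a ∷ as) b (j ∷ ls) with i , e ← tag-∷ʳ as b ls  = i , cong ((a , j) ∷_) e

  tip-tag : ∀ a i as ls → proj₁ (lastFrom (a , i) (tag as ls)) ≡ lastFrom a as
  tip-tag a i []       ls       = refl
  tip-tag a i (b ∷ as) []       = tip-tag b (point M) as []
  tip-tag a i (b ∷ as) (j ∷ ls) = tip-tag b j as ls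

  tag-++ : ∀ as ls r → length as ≤ length ls → tag as (ls ++ r) ≡ tag as ls
  tag-++ []       ls       r _       = refl
  tag-++ (a ∷ as) (i ∷ ls) r (s≤s p) = cong ((a , i) ∷_) (tag-++ as ls r p)

  map-proj₁-tag : ∀ as ls → map proj₁ (tag as ls) ≡ as
  map-proj₁-tag []       ls       = refl
  map-proj₁-tag (a ∷ as) []       = cong (a ∷_) (map-proj₁-tag as [])
  map-proj₁-tag (a ∷ as) (i ∷ ls) = cong (a ∷_) (map-proj₁-tag as ls)

  map-proj₂-tag : ∀ as ls → length as ≤ length ls → ∃[ r ] ls ≡ map proj₂ (tag as ls) ++ r
  map-proj₂-tag []       ls       _       = ls , refl
  map-proj₂-tag (a ∷ as) (i ∷ ls) (s≤s p) with r , e ← map-proj₂-tag as ls p = r , cong (i ∷_) e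

  tag-map : ∀ (ps : List (W A × W M)) → tag (map proj₁ ps) (map proj₂ ps) ≡ ps
  tag-map []       = refl
  tag-map (p ∷ ps) = cong (p ∷_) (tag-map ps)

  len : Labels k → ℕ
  len x = length (toList x)

  D : Diagram (Prefixes k)
  D = record
    { obj    = λ x → Unravel A (len x)
    ; mor    = λ x≼y → record
        { fun    = λ α → widen α (≼⇒length≤ x≼y)
        ; pres-R = id ; pres-P = λ _ → id ; pres-point = refl }
    ; mor-id = λ _ → steps-injective refl
    ; mor-∘  = λ _ _ _ → steps-injective refl }

  ι : (x : Labels k) → UElem A (len x) → W T
  ι x record { steps = as ; bound = b ; chain = c } = record
    { steps = tag as (toList x)
    ; bound = ≤-trans (≤-reflexive (length-tag as (toList x))) (≤-trans b (length-toList x))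
    ; chain = chain-tag (toList x) (point M) c }

  ιₕ : (x : Labels k) → KHom (Unravel A (len x)) T
  ιₕ x = record
    { fun        = ι x
    ; pres-R     = λ {α} (b , e) → let i , e′ = tag-∷ʳ (steps α) b (toList x) in
                     (b , i) , trans (cong (λ as → tag as (toList x)) e) e′
    ; pres-P     = λ p {α} → subst (P A p) (sym (tip-tag (point A) (point M) (steps α) (toList x)))
    ; pres-point = refl }

  cocone : Cocone D T
  cocone = record
    { inj     = ιₕ
    ; commute = λ {x} x≼y α → let r , e = ≼⇒++ x≼y in steps-injective
        (trans (cong (tag (steps α)) e) (tag-++ (steps α) (toList x) r (length-steps α))) }

  labelsOf : W T → Labels k
  labelsOf t = fromList (map proj₂ (steps t))

  toList-labelsOf : ∀ t → toList (labelsOf t) ≡ map proj₂ (steps t)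
  toList-labelsOf t =
    toList-fromList _ (subst (_≤ k) (sym (length-map proj₂ (steps t))) (length-steps t))

  pathOf : (t : W T) → UElem A (len (labelsOf t))
  pathOf t@record { steps = ps ; chain = c } = record
    { steps = map proj₁ ps
    ; bound = ≤-reflexive (trans (length-map proj₁ ps)
                (trans (sym (length-map proj₂ ps)) (sym (cong length (toList-labelsOf t)))))
    ; chain = chain-map proj₁ id c }

  ι-pathOf : ∀ t → ι (labelsOf t) (pathOf t) ≡ t
  ι-pathOf t = steps-injective
    (trans (cong (tag (map proj₁ (steps t))) (toList-labelsOf t)) (tag-map (steps t)))

  module _ (L : KripkeModel Var) (c : Cocone D L) where

    mediate-R : ∀ {t t′} → R T t t′ →
                R L (fun (inj c (labelsOf t)) (pathOf t)) (fun (inj c (labelsOf t′)) (pathOf t′))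
    mediate-R {t} {t′} ((b , i) , e) =
      subst (λ l → R L l (fun (inj c (labelsOf t′)) (pathOf t′)))
            (commute c t≼t′ (pathOf t))
            (pres-R (inj c (labelsOf t′)) edge)
      where
        t≼t′ : labelsOf t ≼ labelsOf t′
        t≼t′ = ++⇒≼ (map proj₂ (steps t)) (labelsOf t′)
          (trans (toList-labelsOf t′) (trans (cong (map proj₂) e) (map-++ proj₂ (steps t) _)))
        edge : R (Unravel A (len (labelsOf t′))) (widen (pathOf t) (≼⇒length≤ t≼t′)) (pathOf t′)
        edge = b , trans (cong (map proj₁) e) (map-++ proj₁ (steps t) _)

    mediate : KHom T L
    mediate = record
      { fun        = λ t → fun (inj c (labelsOf t)) (pathOf t)
      ; pres-R     = λ {t} {t′} → mediate-R {t} {t′}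
      ; pres-P     = λ p {t} → pres-P (inj c (labelsOf t)) p
                       ∘ subst (P A p) (sym (lastFrom-map proj₁ (point A , point M) (steps t)))
      ; pres-point = pres-point (inj c (fromList [])) }

    mediate-factors : ∀ x → (mediate ∘ₕ ιₕ x) ≈ₕ inj c x
    mediate-factors x α =
      trans (sym (commute c ≼x (pathOf (ι x α))))
            (cong (fun (inj c x)) (steps-injective (map-proj₁-tag (steps α) (toList x))))
      where
        ≼x : labelsOf (ι x α) ≼ x
        ≼x = ++⇒≼ _ x (proj₂ (map-proj₂-tag (steps α) (toList x) (length-steps α)))

    mediate-unique : ∀ (v : KHom T L) → (∀ x → (v ∘ₕ ιₕ x) ≈ₕ inj c x) → v ≈ₕ mediate
    mediate-unique v v-factors t =
      trans (cong (fun v) (sym (ι-pathOf t))) (v-factors (labelsOf t) (pathOf t))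

  isColimit : IsColimit D T cocone
  isColimit L c = mediate L c , mediate-factors L c , mediate-unique L c

module Transfer (em : ExcludedMiddle (Level.suc 0ℓ)) {Var : Set} (V : List Var)
                (A M : KripkeModel Var) (k : ℕ) where
  open Classical em
  open BoundedBisimulation V
  open LabelledColimit A M k using (T)

  worldA : W T → W A
  worldA t = proj₁ (tip t)

  worldM : W T → W M
  worldM t = proj₂ (tip t)

  Room : W T → ℕ → Set
  Room t j = length (steps t) + j ≡ k

  room-step : ∀ t t′ {j} → R T t t′ → Room t (suc j) → Room t′ j
  room-step t t′ {j} (x , e) room = begin
    length (steps t′) + j          ≡⟨ cong (λ xs → length xs + j) e ⟩
    length (steps t ∷ʳ x) + j      ≡⟨ cong (_+ j) (length-∷ʳ (steps t) x) ⟩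
    suc (length (steps t)) + j     ≡⟨ sym (+-suc (length (steps t)) j) ⟩
    length (steps t) + suc j       ≡⟨ room ⟩
    k                              ∎
    where open ≡-Reasoning

  room-extend : ∀ t {j} → Room t (suc j) → suc (length (steps t)) ≤ k
  room-extend t {j} room =
    ≤-trans (m≤m+n (suc (length (steps t))) j) (≤-reflexive (trans (sym (+-suc _ j)) room))

  room⇒remaining : ∀ t {j} → Room t j → k ∸ length (steps t) ≡ j
  room⇒remaining t {j} room =
    subst (λ n → n ∸ length (steps t) ≡ j) room (m+n∸m≡n (length (steps t)) j)

  T-bisim-A : ∀ j t → Room t j → Bisim T A j t (worldA t)
  T-bisim-A zero    t _    = λ _ → ⇔-id _
  T-bisim-A (suc j) t room = (λ _ → ⇔-id _) , forth , back
    where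
      forth : Forth T A (Bisim T A j) t (worldA t)
      forth {t′} r = worldA t′ , unravel-edge em t t′ r , T-bisim-A j t′ (room-step t t′ r room)
      back : Back T A (Bisim T A j) t (worldA t)
      back {a′} r = t′ , (_ , refl) ,
        subst (Bisim T A j t′ ∘ proj₁) (tip-∷ʳ t t′ refl)
          (T-bisim-A j t′ (room-step t t′ (_ , refl) room))
        where
          t′ : W T
          t′ = extend t {a′ , point M} r (room-extend t room)

  -- Checking the last step suffices: an edge of N appends one step to a node of N.
  LastStepInM : List (W A × W M) → Set
  LastStepInM ys = ∀ {xs x} → ys ≡ xs ∷ʳ x → R M (proj₂ (lastFrom (point A , point M) xs)) (proj₂ x)

  Tracked : W T → Set
  Tracked t = LastStepInM (steps t) × Sim M A (k ∸ length (steps t)) (worldM t) (worldA t)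

  extend-tracked : ∀ {j} t (room : Room t (suc j)) {a′ m′} (ra : R A (worldA t) a′) →
                   R M (worldM t) m′ → Sim M A j m′ a′ →
                   Tracked (extend t {a′ , m′} ra (room-extend t room))
  extend-tracked t room {a′} {m′} ra rm s = last-step , sim′
    where
      t′ : W T
      t′ = extend t ra (room-extend t room)
      last-step : LastStepInM (steps t′)
      last-step {xs} e with refl , refl ← ∷ʳ-injective (steps t) xs e = rm
      sim′ : Sim M A (k ∸ length (steps t′)) (worldM t′) (worldA t′)
      sim′ = subst₂ (λ n z → Sim M A n (proj₂ z) (proj₁ z))
               (sym (room⇒remaining t′ (room-step t t′ (_ , refl) room)))
               (sym (tip-∷ʳ t t′ refl)) s

  module _ (sim : Sim M A k (point M) (point A)) where

    root-tracked : Tracked (point T)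
    root-tracked = (λ {xs} e → ⊥-elim ([]≢∷ʳ xs _ e)) , sim

    N : KripkeModel Var
    N = Submodel T Tracked root-tracked

    tracked : (t : W N) → Tracked (elem t)
    tracked record { mem = t∈N } = recover t∈N

    sim-at : ∀ {j} (t : W N) → Room (elem t) j → Sim M A j (worldM (elem t)) (worldA (elem t))
    sim-at t room = subst (λ n → Sim M A n _ _) (room⇒remaining (elem t) room) (proj₂ (tracked t))

    M-bisim-N : ∀ j (t : W N) → Room (elem t) j → Bisim M N j (worldM (elem t)) t
    M-bisim-N zero    t room = sim-at t room
    M-bisim-N (suc j) t room = proj₁ (sim-at t room) , forth , back
      where
        forth : Forth M N (Bisim M N j) (worldM (elem t)) t
        forth rm with a′ , ra , s′ ← proj₂ (sim-at t room) rm =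
          t′ , (_ , refl) ,
          subst (λ z → Bisim M N j (proj₂ z) t′) (tip-∷ʳ (elem t) (elem t′) refl)
            (M-bisim-N j t′ (room-step (elem t) (elem t′) (_ , refl) room))
          where
            t′ : W N
            t′ = record { elem = extend (elem t) ra (room-extend (elem t) room)
                        ; mem  = extend-tracked (elem t) room ra rm s′ }
        back : Back M N (Bisim M N j) (worldM (elem t)) t
        back {t′} r@(x , e) =
          worldM (elem t′) ,
          subst (R M _ ∘ proj₂) (sym (tip-∷ʳ (elem t) (elem t′) e)) (proj₁ (tracked t′) e) ,
          M-bisim-N j t′ (room-step (elem t) (elem t′) r room)

    transfer : (C : KripkeModel Var → Set) → ClosedUnderSubmodels C → C T →
               ∀ φ → PreservedUnderExtensionsWithin C φ → depth φ ≤ k → vars φ ⊆ V →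
               M ⊨ φ → A ⊨ φ
    transfer C submodel∈C T∈C φ preserved d φ⊆V M⊨φ =
      to (Sat-bisim φ d φ⊆V (T-bisim-A k (point T) refl))
        (preserved N T (submodel∈C T T∈C Tracked root-tracked) T∈C
          (submodel-embedding T Tracked root-tracked)
          (to (Sat-bisim φ d φ⊆V (M-bisim-N k (point N) refl)) M⊨φ))

Labels-finite : {I : Set} → Finite I → ∀ n → Finite (Labels.Labels I n)
Labels-finite _              zero    = 1 , ↔-sym 1↔⊤
Labels-finite fin@(a , I↔Fin) (suc n) with b , L↔Fin ← Labels-finite fin n =
  suc (a * b) ,
  ↔-trans (↔-sym 1↔⊤ ⊎-↔ (I↔Fin ×-↔ L↔Fin))
          (↔-trans (↔-id _ ⊎-↔ ↔-sym (*↔× {a} {b})) (↔-sym (+↔⊎ {1})))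

Dec-irrelevant⇒Finite : {Q : Set} → Dec Q → (∀ (p q : Q) → p ≡ q) → Finite Q
Dec-irrelevant⇒Finite (yes p) irr = 1 , mk↔ₛ′ (λ _ → zero) (λ _ → p) (λ { zero → refl }) (irr p)
Dec-irrelevant⇒Finite (no ¬p) irr = 0 , mk↔ₛ′ (⊥-elim ∘ ¬p) (λ ()) (λ ()) (⊥-elim ∘ ¬p)

Prefixes-finite : ExcludedMiddle (Level.suc 0ℓ) → {I : Set} → Finite I →
                  ∀ n → FiniteCategory (Labels.Prefixes I n)
Prefixes-finite em {I} fin n =
  Labels-finite fin n , λ x y → Dec-irrelevant⇒Finite (dec _) ≼-irrelevant
  where open Classical em
        open Labels I

closure⇒labelled-unravel∈C :
  ExcludedMiddle (Level.suc 0ℓ) → {Var : Set} (C : KripkeModel Var → Set) →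
  ((ClosedUnderSubmodels C × ClosedUnderColimits C)
    ⊎ ((∀ A → C A → Finite (W A)) × ClosedUnderSubmodels C × ClosedUnderFiniteColimits C)) →
  (∀ A → C A → ∀ k → C (Unravel A k)) →
  ∀ {A M} → C A → C M → ∀ k → C (Unravel (Labelled A M) k)
closure⇒labelled-unravel∈C em C (inj₁ (_ , colimit∈C)) unravel∈C {A} {M} A∈C _ k =
  colimit∈C (Prefixes k) D (λ x → unravel∈C A A∈C (len x)) T cocone isColimit
  where open LabelledColimit A M k
        open Labels (W M) using (Prefixes)
closure⇒labelled-unravel∈C em C (inj₂ (finite , _ , colimit∈C)) unravel∈C {A} {M} A∈C M∈C k =
  colimit∈C (Prefixes k) (Prefixes-finite em (finite M M∈C) k) D (λ x → unravel∈C A A∈C (len x))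
            T cocone isColimit
  where open LabelledColimit A M k
        open Labels (W M) using (Prefixes)

module _ (em : ExcludedMiddle (Level.suc 0ℓ)) {Var : Set} (C : KripkeModel Var → Set)
         (submodel∈C : ClosedUnderSubmodels C)
         (labelled∈C : ∀ {A M} → C A → C M → ∀ k → C (Unravel (Labelled A M) k))
         (k : ℕ) (φ : Formula Var) (depth≤k : depth φ ≤ k) where
  open Characteristic em (vars φ)

  CharacterisesModelOf : Formula Var → Set₁
  CharacterisesModelOf χ = ∃[ M ] C M × M ⊨ φ × characteristic M k (point M) ≡ χ

  characterisesModelOf? : Decidable CharacterisesModelOf
  characterisesModelOf? _ = em

  χs : List (Formula Var)
  χs = filter characterisesModelOf? (conjunctions (choices k))

  Sat-⋁χs : ∀ A → C A → A ⊨ φ → A ⊨ ⋁ χs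
  Sat-⋁χs A A∈C A⊨φ = from (Sat-⋁ χs) (lose χA∈χs (Sat-characteristic A k (point A)))
    where
      χA∈χs : characteristic A k (point A) ∈ χs
      χA∈χs = ∈-filter⁺ characterisesModelOf? (characteristic∈ A k (point A)) (A , A∈C , A⊨φ , refl)

  Sat-⋁χs⇒characteristic : ∀ {A} → A ⊨ ⋁ χs →
                           ∃[ M ] C M × M ⊨ φ × A ⊨ characteristic M k (point M)
  Sat-⋁χs⇒characteristic {A} A⊨⋁χs =
    let χ , χ∈χs , A⊨χ         = find (to (Sat-⋁ χs) A⊨⋁χs)
        _ , M , M∈C , M⊨φ , χM =
          ∈-filter⁻ characterisesModelOf? {xs = conjunctions (choices k)} χ∈χs
    in M , M∈C , M⊨φ , subst (Sat A (point A)) (sym χM) A⊨χ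

  preserved⇒existential : PreservedUnderExtensionsWithin C φ →
    Σ (Formula Var) (λ ψ → IsExistential ψ × depth ψ ≤ k × (∀ A → C A → (A ⊨ φ ⇔ A ⊨ ψ)))
  preserved⇒existential preserved =
    let ⋁χs-existential , ⋁χs-depth =
          ⋁-existential≤ (All-filter⁺ characterisesModelOf? (characteristic-existential≤ k))
    in ⋁ χs , ⋁χs-existential , ⋁χs-depth , λ A A∈C → mk⇔ (Sat-⋁χs A A∈C) (Sat-⋁χs⇒φ A A∈C)
    where
      Sat-⋁χs⇒φ : ∀ A → C A → A ⊨ ⋁ χs → A ⊨ φ
      Sat-⋁χs⇒φ A A∈C A⊨⋁χs =
        let M , M∈C , M⊨φ , A⊨χM = Sat-⋁χs⇒characteristic A⊨⋁χs
        in Transfer.transfer em (vars φ) A M k (characteristic⇒Sim k A⊨χM)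
             C submodel∈C (labelled∈C A∈C M∈C k) φ preserved depth≤k id M⊨φ

corollary5p2 : ExcludedMiddle (Level.suc 0ℓ) →
    (Var : Set) (C : KripkeModel Var → Set) →
    ((ClosedUnderSubmodels C × ClosedUnderColimits C)
      ⊎ ((∀ A → C A → Finite (W A)) × ClosedUnderSubmodels C × ClosedUnderFiniteColimits C)) →
    (∀ A → C A → ∀ (k : ℕ) → C (Unravel A k)) →
    ∀ (k : ℕ) (φ : Formula Var) → depth φ ≤ k →
    (PreservedUnderExtensionsWithin C φ
      ⇔ Σ (Formula Var) (λ ψ → IsExistential ψ × depth ψ ≤ k
                          × (∀ A → C A → (A ⊨ φ ⇔ A ⊨ ψ))))
corollary5p2 em Var C closure unravel∈C k φ depth≤k = mk⇔
  (preserved⇒existential em C submodel∈C labelled∈C k φ depth≤k)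
  (λ (ψ , ψ-existential , _ , φ⇔ψ) →
     preserved-resp-⇔ {φ = φ} {ψ} φ⇔ψ (existential⇒preserved ψ-existential C))
  where
    submodel∈C : ClosedUnderSubmodels C
    submodel∈C = [ proj₁ , proj₁ ∘ proj₂ ]′ closure
    labelled∈C : ∀ {A M} → C A → C M → ∀ k → C (Unravel (Labelled A M) k)
    labelled∈C = closure⇒labelled-unravel∈C em C closure unravel∈C
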